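{- Let $q$ be an odd prime power, let $E\subset\mathbb{F}_q^2$, $n:=|E|$, and $K_E:=\max_{u\in \mathbb{F}_q}|E\cap(\{u\}\times\mathbb{F}_q)|$. For $t\in\mathbb{F}_q$ let $\nu(t):=|\{(\mathbf{x},\mathbf{y})\in E^2:\|\mathbf{x}-\mathbf{y}\|_P=t\}|$. Then \[ \sum_{t\in\mathbb{F}_q}\nu(t)^2\le \frac{n^4}{q}+qn^2K_E. \]
   Context: For $\mathbf{x}=(x_1,x_2),\mathbf{y}=(y_1,y_2)\in\mathbb{F}_q^2$, the parabolic distance is $\|\mathbf{x}-\mathbf{y}\|_P:=(x_2-y_2)+(x_1-y_1)^2\in\mathbb{F}_q$. -}

module Defs where

open import Level using (0ℓ)
open import Data.Nat using (ℕ; suc; _⊔_; _^_)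
open import Data.Nat.Primality using (Prime)
open import Data.Bool using (Bool; _∧_)
open import Data.Fin using (Fin)
open import Data.List using (List; map; filter; length; allFin; cartesianProduct; foldr)
open import Data.Product using (_×_; _,_; ∃; Σ)
open import Relation.Nullary using (¬_)
open import Relation.Nullary.Decidable using (⌊_⌋)
open import Relation.Binary.Definitions using (DecidableEquality)
open import Relation.Binary.PropositionalEquality using (_≡_)
open import Algebra.Structures using (IsCommutativeRing)
open import Function.Bundles using (_↔_; Inverse)

IsPrimePower : ℕ → Set
IsPrimePower q = ∃ λ p → ∃ λ k → Prime p × (q ≡ p ^ suc k)

record FiniteField (q : ℕ) : Set₁ where
  infixl 6 _+_
  infixl 7 _*_
  field
    Carrier : Set
    _+_ _*_ : Carrier → Carrier → Carrier
    -_ : Carrier → Carrier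
    0# 1# : Carrier
    isCommutativeRing : IsCommutativeRing _≡_ _+_ _*_ -_ 0# 1#
    0≢1 : ¬ (0# ≡ 1#)
    inverse : ∀ x → ¬ (x ≡ 0#) → Σ Carrier (λ y → x * y ≡ 1#)
    _≟_ : DecidableEquality Carrier
    enum : Fin q ↔ Carrier

  _-_ : Carrier → Carrier → Carrier
  x - y = x + (- y)

  elems : List Carrier
  elems = map (Inverse.to enum) (allFin q)

  Point : Set
  Point = Carrier × Carrier

  points : List Point
  points = cartesianProduct elems elems

  -- parabolic distance ‖x - y‖_P = (x₂ - y₂) + (x₁ - y₁)²
  parDist : Point → Point → Carrier
  parDist (x₁ , x₂) (y₁ , y₂) = (x₂ - y₂) + (x₁ - y₁) * (x₁ - y₁)

count : {A : Set} → (A → Bool) → List A → ℕ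
count P xs = length (filter (λ a → P a Data.Bool.≟ Data.Bool.true) xs)

module _ {q : ℕ} (F : FiniteField q) (E : FiniteField.Point F → Bool) where
  open FiniteField F

  size : ℕ
  size = count E points

  column : Carrier → ℕ
  column u = count (λ p → E p ∧ ⌊ Data.Product.proj₁ p ≟ u ⌋) points

  KE : ℕ
  KE = foldr _⊔_ 0 (map column elems)

  ν : Carrier → ℕ
  ν t = count (λ xy → E (Data.Product.proj₁ xy) ∧ E (Data.Product.proj₂ xy)
                       ∧ ⌊ parDist (Data.Product.proj₁ xy) (Data.Product.proj₂ xy) ≟ t ⌋)
              (cartesianProduct points points)

  sumν² : ℕ
  sumν² = foldr (λ t acc → ν t Data.Nat.* ν t Data.Nat.+ acc) 0 elems

{-# OPTIONS --safe #-}
-- Write ν t = ∑ₓ ρₓ t over x ∈ E, where ρₓ t counts the y ∈ E with ‖x - y‖_P = t. As ∑ₜ ν t = n²,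
-- the claim says that the variance ∑ₜ (q ν t - n²)² is at most q³ n² K_E. By Cauchy–Schwarz over x
-- it is at most n ∑ₓ ∑ₜ (q ρₓ t - n)², and the inner sum equals q (q C(x₁) - n²), where C(u) counts
-- the pairs (y, y′) ∈ E² equidistant from (u, 0): moving x vertically only shifts all distances.
-- Grouping the x ∈ E by column costs the factor K_E, and ∑ᵤ C(u) ≤ q n + n² because for y ≠ y′
-- the condition ‖(u, 0) - y‖_P = ‖(u, 0) - y′‖_P reads 2 (y₁′ - y₁) u = c with c ≠ 0 when y₁ = y₁′,
-- so it has at most one solution u once 2 ≠ 0, which holds as q is odd.

module Submission where

open import Defs
open import Level using (0ℓ)
open import Data.Bool using (Bool; true; false; _∧_)
open import Data.Nat as ℕ using (ℕ; zero; suc; _%_)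
import Data.Nat.Properties as ℕ
open import Data.Nat.DivMod using (m*n%n≡0)
open import Data.Fin using (Fin; zero; suc)
import Data.Fin as Fin
import Data.Fin.Properties as Fin
open import Data.List using (List; []; _∷_; _++_; map; length; foldr; allFin; cartesianProduct)
import Data.List.Properties as List
open import Data.List.Relation.Unary.Any using (Any; here; there; any?; satisfied)
open import Data.List.Membership.Propositional using (_∈_)
open import Data.List.Membership.Propositional.Properties using (∈-map⁺; ∈-allFin)
open import Data.Product using (_×_; _,_; proj₁; uncurry)
open import Data.Product.Properties using (≡-dec; ,-injective)
open import Function using (_∘_; id; _↔_; _⇔_; Inverse; mk↔ₛ′; mk⇔)
open import Algebra.Bundles using (CommutativeRing)
open import Relation.Nullary using (¬_; Dec; yes; no; contradiction; _×-dec_)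
open import Relation.Nullary.Decidable using (⌊_⌋; does; dec-true; dec-false; does-⇔; isYes≗does)
open import Relation.Unary using (Pred; Decidable)
open import Relation.Binary.Definitions using (DecidableEquality; tri<; tri≈; tri>)
open import Relation.Binary.PropositionalEquality

∈⇒≤foldr-⊔ : ∀ {m ns} → m ∈ ns → m ℕ.≤ foldr ℕ._⊔_ 0 ns
∈⇒≤foldr-⊔ (here refl)              = ℕ.m≤m⊔n _ _
∈⇒≤foldr-⊔ {ns = n ∷ _} (there m∈ns) = ℕ.≤-trans (∈⇒≤foldr-⊔ m∈ns) (ℕ.m≤n⊔m n _)

module Counting where

  open import Data.Integer as ℤ using (ℤ; +_; -[1+_]; 0ℤ; 1ℤ; _+_; -_; _-_; _*_; _^_; _≤_; +≤+; ∣_∣)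
  import Data.Integer.Properties as ℤ
  open import Data.Integer.Tactic.RingSolver using (solve-∀)

  infix 8 _²

  _² : ℤ → ℤ
  i ² = i * i

  0≤i² : ∀ i → 0ℤ ≤ i ²
  0≤i² (+ n)    = subst (0ℤ ≤_) (ℤ.pos-* n n) (+≤+ ℕ.z≤n)
  0≤i² -[1+ n ] = +≤+ ℕ.z≤n

  0≤i*j : ∀ {i j} → 0ℤ ≤ i → 0ℤ ≤ j → 0ℤ ≤ i * j
  0≤i*j {+ m} {+ n} _ _ = subst (0ℤ ≤_) (ℤ.pos-* m n) (+≤+ ℕ.z≤n)

  𝟙 : Bool → ℤ
  𝟙 true  = 1ℤ
  𝟙 false = 0ℤ

  𝟙-∧ : ∀ x y → 𝟙 (x ∧ y) ≡ 𝟙 x * 𝟙 y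
  𝟙-∧ true  y = sym (ℤ.*-identityˡ (𝟙 y))
  𝟙-∧ false y = refl

  𝟙-idem : ∀ x → 𝟙 x * 𝟙 x ≡ 𝟙 x
  𝟙-idem true  = refl
  𝟙-idem false = refl

  0≤𝟙 : ∀ x → 0ℤ ≤ 𝟙 x
  0≤𝟙 true  = +≤+ ℕ.z≤n
  0≤𝟙 false = +≤+ ℕ.z≤n

  𝟙≤1 : ∀ x → 𝟙 x ≤ 1ℤ
  𝟙≤1 true  = ℤ.≤-refl
  𝟙≤1 false = +≤+ ℕ.z≤n

  𝟙-does : ∀ {P : Set} (P? : Dec P) → 𝟙 ⌊ P? ⌋ ≡ 𝟙 (does P?)
  𝟙-does P? = cong 𝟙 (isYes≗does P?)

  private
    variable
      A B : Set

  ∑ : List A → (A → ℤ) → ℤ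
  ∑ []       f = 0ℤ
  ∑ (x ∷ xs) f = f x + ∑ xs f

  infixr 10 ∑
  syntax ∑ xs (λ x → e) = ∑[ x ∈ xs ] e

  ∑-cong : ∀ xs {f g : A → ℤ} → (∀ x → f x ≡ g x) → ∑ xs f ≡ ∑ xs g
  ∑-cong []       f≗g = refl
  ∑-cong (x ∷ xs) f≗g = cong₂ _+_ (f≗g x) (∑-cong xs f≗g)

  ∑-distrib-+ : ∀ xs (f g : A → ℤ) → ∑[ x ∈ xs ] (f x + g x) ≡ ∑ xs f + ∑ xs g
  ∑-distrib-+ []       f g = refl
  ∑-distrib-+ (x ∷ xs) f g = trans (cong (_+_ (f x + g x)) (∑-distrib-+ xs f g)) (middleFour (f x) (g x) _ _)
    where
    middleFour : ∀ a b c d → a + b + (c + d) ≡ a + c + (b + d)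
    middleFour = solve-∀

  ∑-distrib-- : ∀ (xs : List A) (f g : A → ℤ) → ∑[ x ∈ xs ] (f x - g x) ≡ ∑ xs f - ∑ xs g
  ∑-distrib-- []       f g = refl
  ∑-distrib-- (x ∷ xs) f g = trans (cong (_+_ (f x - g x)) (∑-distrib-- xs f g)) (middleFour (f x) (g x) _ _)
    where
    middleFour : ∀ a b c d → a - b + (c - d) ≡ a + c - (b + d)
    middleFour = solve-∀

  ∑-*ˡ : ∀ xs c (f : A → ℤ) → ∑[ x ∈ xs ] (c * f x) ≡ c * ∑ xs f
  ∑-*ˡ []       c f = sym (ℤ.*-zeroʳ c)
  ∑-*ˡ (x ∷ xs) c f = trans (cong (_+_ (c * f x)) (∑-*ˡ xs c f)) (sym (ℤ.*-distribˡ-+ c (f x) (∑ xs f)))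

  ∑-*ʳ : ∀ xs c (f : A → ℤ) → ∑[ x ∈ xs ] (f x * c) ≡ ∑ xs f * c
  ∑-*ʳ xs c f = begin
    ∑[ x ∈ xs ] (f x * c)  ≡⟨ ∑-cong xs (λ x → ℤ.*-comm (f x) c) ⟩
    ∑[ x ∈ xs ] (c * f x)  ≡⟨ ∑-*ˡ xs c f ⟩
    c * ∑ xs f           ≡⟨ ℤ.*-comm c (∑ xs f) ⟩
    ∑ xs f * c           ∎
    where open ≡-Reasoning

  ∑-const : (xs : List A) (c : ℤ) → ∑[ x ∈ xs ] c ≡ + length xs * c
  ∑-const []       c = sym (ℤ.*-zeroˡ c)
  ∑-const (x ∷ xs) c = trans (cong (_+_ c) (∑-const xs c)) (1+l*c c (+ length xs))
    where
    1+l*c : ∀ c l → c + l * c ≡ (1ℤ + l) * c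
    1+l*c = solve-∀

  ∑-zero : (xs : List A) → ∑[ x ∈ xs ] 0ℤ ≡ 0ℤ
  ∑-zero xs = trans (∑-const xs 0ℤ) (ℤ.*-zeroʳ (+ length xs))

  ∑-mono-≤ : ∀ xs {f g : A → ℤ} → (∀ x → f x ≤ g x) → ∑ xs f ≤ ∑ xs g
  ∑-mono-≤ []       f≤g = ℤ.≤-refl
  ∑-mono-≤ (x ∷ xs) f≤g = ℤ.+-mono-≤ (f≤g x) (∑-mono-≤ xs f≤g)

  ∑-nonNeg : ∀ xs {f : A → ℤ} → (∀ x → 0ℤ ≤ f x) → 0ℤ ≤ ∑ xs f
  ∑-nonNeg xs {f} 0≤f = subst (_≤ ∑ xs f) (∑-zero xs) (∑-mono-≤ xs 0≤f)

  ∑-++ : ∀ xs ys (f : A → ℤ) → ∑ (xs ++ ys) f ≡ ∑ xs f + ∑ ys f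
  ∑-++ []       ys f = sym (ℤ.+-identityˡ (∑ ys f))
  ∑-++ (x ∷ xs) ys f = trans (cong (_+_ (f x)) (∑-++ xs ys f)) (sym (ℤ.+-assoc (f x) _ _))

  count≡∑𝟙 : ∀ (P : A → Bool) xs → + count P xs ≡ ∑[ x ∈ xs ] 𝟙 (P x)
  count≡∑𝟙 P []       = refl
  count≡∑𝟙 P (x ∷ xs) with P x
  ... | true  = trans (ℤ.pos-+ 1 _) (cong (_+_ 1ℤ) (count≡∑𝟙 P xs))
  ... | false = trans (count≡∑𝟙 P xs) (sym (ℤ.+-identityˡ _))

  pos-^ : ∀ m n → + (m ℕ.^ n) ≡ (+ m) ^ n
  pos-^ m zero    = refl
  pos-^ m (suc n) = trans (ℤ.pos-* m (m ℕ.^ n)) (cong (+ m *_) (pos-^ m n))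

  pos-∑-² : ∀ (f : A → ℕ) xs → + foldr (λ x acc → f x ℕ.* f x ℕ.+ acc) 0 xs ≡ ∑[ x ∈ xs ] ((+ f x) ²)
  pos-∑-² f []       = refl
  pos-∑-² f (x ∷ xs) = trans (ℤ.pos-+ (f x ℕ.* f x) _) (cong₂ _+_ (ℤ.pos-* (f x) (f x)) (pos-∑-² f xs))

  ∑-map : ∀ (g : A → B) xs (f : B → ℤ) → ∑ (map g xs) f ≡ ∑[ x ∈ xs ] f (g x)
  ∑-map g []       f = refl
  ∑-map g (x ∷ xs) f = cong (_+_ (f (g x))) (∑-map g xs f)

  ∑-swap : ∀ xs ys (f : A → B → ℤ) → ∑[ x ∈ xs ] ∑[ y ∈ ys ] f x y ≡ ∑[ y ∈ ys ] ∑[ x ∈ xs ] f x y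
  ∑-swap []       ys f = sym (∑-zero ys)
  ∑-swap (x ∷ xs) ys f = trans (cong (_+_ (∑ ys (f x))) (∑-swap xs ys f))
                               (sym (∑-distrib-+ ys (f x) (λ y → ∑[ x′ ∈ xs ] f x′ y)))

  ∑-cartesianProduct : ∀ xs ys (f : A × B → ℤ) →
                       ∑ (cartesianProduct xs ys) f ≡ ∑[ x ∈ xs ] ∑[ y ∈ ys ] f (x , y)
  ∑-cartesianProduct []       ys f = refl
  ∑-cartesianProduct (x ∷ xs) ys f = begin
    ∑ (map (x ,_) ys ++ cartesianProduct xs ys) f
      ≡⟨ ∑-++ (map (x ,_) ys) _ f ⟩
    ∑ (map (x ,_) ys) f + ∑ (cartesianProduct xs ys) f
      ≡⟨ cong₂ _+_ (∑-map (x ,_) ys f) (∑-cartesianProduct xs ys f) ⟩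
    ∑[ y ∈ ys ] f (x , y) + ∑[ x′ ∈ xs ] ∑[ y ∈ ys ] f (x′ , y)
      ∎
    where open ≡-Reasoning

  ∑-distrib-+₃ : ∀ (xs : List A) (f g h : A → ℤ) →
                 ∑[ x ∈ xs ] (f x + g x + h x) ≡ ∑ xs f + ∑ xs g + ∑ xs h
  ∑-distrib-+₃ xs f g h = trans (∑-distrib-+ xs (λ x → f x + g x) h) (cong (_+ ∑ xs h) (∑-distrib-+ xs f g))

  ∑∑-separable : ∀ (xs : List A) (ys : List B) (f : A → ℤ) (g : B → ℤ) →
                 ∑[ x ∈ xs ] ∑[ y ∈ ys ] (f x * g y) ≡ ∑ xs f * ∑ ys g
  ∑∑-separable xs ys f g = trans (∑-cong xs (λ x → ∑-*ˡ ys (f x) g)) (∑-*ʳ xs (∑ ys g) f)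

  ∑-deviation² : ∀ (xs : List A) (f : A → ℤ) {L S} → + length xs ≡ L → ∑ xs f ≡ S →
                 ∑[ x ∈ xs ] ((L * f x - S) ²) ≡ L * (L * ∑[ x ∈ xs ] (f x ²) - S ²)
  ∑-deviation² xs f refl refl = begin
    ∑[ x ∈ xs ] ((L * f x - S) ²)                                   ≡⟨ ∑-cong xs (λ x → expand L S (f x)) ⟩
    ∑[ x ∈ xs ] (L * L * f x ² + - (+ 2 * L * S) * f x + S ²)       ≡⟨ ∑-distrib-+₃ xs _ _ _ ⟩
    ∑[ x ∈ xs ] (L * L * f x ²) + ∑[ x ∈ xs ] (- (+ 2 * L * S) * f x) + ∑[ x ∈ xs ] (S ²)
      ≡⟨ cong₂ _+_ (cong₂ _+_ (∑-*ˡ xs (L * L) (λ x → f x ²)) (∑-*ˡ xs (- (+ 2 * L * S)) f)) (∑-const xs (S ²)) ⟩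
    L * L * ∑[ x ∈ xs ] (f x ²) + - (+ 2 * L * S) * S + L * S ²     ≡⟨ collect L S _ ⟩
    L * (L * ∑[ x ∈ xs ] (f x ²) - S ²)                             ∎
    where
    open ≡-Reasoning
    L = + length xs
    S = ∑ xs f
    expand : ∀ L S y → (L * y - S) * (L * y - S) ≡ L * L * (y * y) + - (+ 2 * L * S) * y + S * S
    expand = solve-∀
    collect : ∀ L S T → L * L * T + - (+ 2 * L * S) * S + L * (S * S) ≡ L * (L * T - S * S)
    collect = solve-∀

  ∑-cauchySchwarz : ∀ (xs : List A) (w a : A → ℤ) → (∀ x → 0ℤ ≤ w x) →
                    (∑[ x ∈ xs ] (w x * a x)) ² ≤ ∑ xs w * ∑[ x ∈ xs ] (w x * a x ²)
  ∑-cauchySchwarz xs w a 0≤w = ℤ.0≤i-j⇒j≤i (ℤ.*-cancelˡ-≤-pos 0ℤ (W * T - S ²) (+ 2) 0≤2[WT-S²])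
    where
    W = ∑ xs w
    S = ∑[ x ∈ xs ] (w x * a x)
    T = ∑[ x ∈ xs ] (w x * a x ²)
    pointwise : ∀ wx wy ax ay → wx * wy * ((ax - ay) * (ax - ay))
                ≡ wx * (ax * ax) * wy + wx * (wy * (ay * ay)) + - (+ 2) * (wx * ax) * (wy * ay)
    pointwise = solve-∀
    collect : ∀ W S T → T * W + W * T + - (+ 2) * S * S ≡ + 2 * (W * T - S * S)
    collect = solve-∀
    lagrange : ∑[ x ∈ xs ] ∑[ y ∈ xs ] (w x * w y * (a x - a y) ²) ≡ + 2 * (W * T - S ²)
    lagrange = begin
      ∑[ x ∈ xs ] ∑[ y ∈ xs ] (w x * w y * (a x - a y) ²)
        ≡⟨ ∑-cong xs (λ x → trans (∑-cong xs (λ y → pointwise (w x) (w y) (a x) (a y))) (∑-distrib-+₃ xs _ _ _)) ⟩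
      ∑[ x ∈ xs ] (∑[ y ∈ xs ] (w x * a x ² * w y) + ∑[ y ∈ xs ] (w x * (w y * a y ²))
                  + ∑[ y ∈ xs ] (- (+ 2) * (w x * a x) * (w y * a y)))
        ≡⟨ ∑-distrib-+₃ xs _ _ _ ⟩
      ∑[ x ∈ xs ] ∑[ y ∈ xs ] (w x * a x ² * w y) + ∑[ x ∈ xs ] ∑[ y ∈ xs ] (w x * (w y * a y ²))
                  + ∑[ x ∈ xs ] ∑[ y ∈ xs ] (- (+ 2) * (w x * a x) * (w y * a y))
        ≡⟨ cong₂ _+_ (cong₂ _+_ (∑∑-separable xs xs _ w) (∑∑-separable xs xs w _))
                     (trans (∑∑-separable xs xs (λ x → - (+ 2) * (w x * a x)) _)
                            (cong (_* S) (∑-*ˡ xs (- (+ 2)) (λ x → w x * a x)))) ⟩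
      T * W + W * T + - (+ 2) * S * S                                  ≡⟨ collect W S T ⟩
      + 2 * (W * T - S ²)                                              ∎
      where open ≡-Reasoning
    0≤2[WT-S²] : + 2 * 0ℤ ≤ + 2 * (W * T - S ²)
    0≤2[WT-S²] = subst (0ℤ ≤_) lagrange
      (∑-nonNeg xs (λ x → ∑-nonNeg xs (λ y → 0≤i*j (0≤i*j (0≤w x) (0≤w y)) (0≤i² (a x - a y)))))

  module Delta {A : Set} (_≟_ : DecidableEquality A) where

    δ : A → A → ℤ
    δ a b = 𝟙 (does (a ≟ b))

    δ-≡ : ∀ {a b} → a ≡ b → δ a b ≡ 1ℤ
    δ-≡ {a} {b} a≡b = cong 𝟙 (dec-true (a ≟ b) a≡b)

    δ-≢ : ∀ {a b} → a ≢ b → δ a b ≡ 0ℤ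
    δ-≢ {a} {b} a≢b = cong 𝟙 (dec-false (a ≟ b) a≢b)

    δ-cong : ∀ {a b c d} → a ≡ b ⇔ c ≡ d → δ a b ≡ δ c d
    δ-cong {a} {b} {c} {d} a≡b⇔c≡d = cong 𝟙 (does-⇔ a≡b⇔c≡d (a ≟ b) (c ≟ d))

    δ-comm : ∀ a b → δ a b ≡ δ b a
    δ-comm a b = δ-cong (mk⇔ sym sym)

    δ-mul : ∀ a b (f : A → ℤ) → δ a b * f b ≡ δ a b * f a
    δ-mul a b f with a ≟ b
    ... | yes refl = refl
    ... | no  _    = refl

    record Enumerates (xs : List A) : Set where
      field once : ∀ a → ∑[ x ∈ xs ] δ a x ≡ 1ℤ

    module _ {xs : List A} (enum : Enumerates xs) where

      open Enumerates enum

      ∑-δ : ∀ a (f : A → ℤ) → ∑[ x ∈ xs ] (δ a x * f x) ≡ f a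
      ∑-δ a f = begin
        ∑[ x ∈ xs ] (δ a x * f x)  ≡⟨ ∑-cong xs (λ x → δ-mul a x f) ⟩
        ∑[ x ∈ xs ] (δ a x * f a)  ≡⟨ ∑-*ʳ xs (f a) (δ a) ⟩
        ∑[ x ∈ xs ] δ a x * f a    ≡⟨ cong (_* f a) (once a) ⟩
        1ℤ * f a                   ≡⟨ ℤ.*-identityˡ (f a) ⟩
        f a                        ∎
        where open ≡-Reasoning

      ∑-reindex : ∀ (σ : A ↔ A) (f : A → ℤ) → ∑[ x ∈ xs ] f (Inverse.to σ x) ≡ ∑ xs f
      ∑-reindex σ f = begin
        ∑[ x ∈ xs ] f (to x)                         ≡⟨ ∑-cong xs (λ x → sym (∑-δ (to x) f)) ⟩
        ∑[ x ∈ xs ] ∑[ y ∈ xs ] (δ (to x) y * f y)   ≡⟨ ∑-swap xs xs _ ⟩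
        ∑[ y ∈ xs ] ∑[ x ∈ xs ] (δ (to x) y * f y)   ≡⟨ ∑-cong xs (λ y → ∑-cong xs (λ x → cong (_* f y) (δ-to x y))) ⟩
        ∑[ y ∈ xs ] ∑[ x ∈ xs ] (δ (from y) x * f y) ≡⟨ ∑-cong xs (λ y → ∑-δ (from y) (λ _ → f y)) ⟩
        ∑ xs f                                       ∎
        where
        open ≡-Reasoning
        open Inverse σ
        δ-to : ∀ x y → δ (to x) y ≡ δ (from y) x
        δ-to x y = δ-cong (mk⇔ (inverseʳ ∘ sym) (inverseˡ ∘ sym))

      ∑-𝟙-atMostOne : ∀ {P : Pred A 0ℓ} (P? : Decidable P) → (∀ {u v} → P u → P v → u ≡ v) →
                      ∑[ u ∈ xs ] 𝟙 (does (P? u)) ≤ 1ℤ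
      ∑-𝟙-atMostOne P? unique with any? P? xs
      ... | yes ∃P with satisfied ∃P
      ...   | u₀ , Pu₀ = subst (_ ≤_) (once u₀) (∑-mono-≤ xs 𝟙≤δu₀)
        where
        𝟙≤δu₀ : ∀ u → 𝟙 (does (P? u)) ≤ δ u₀ u
        𝟙≤δu₀ u with P? u
        ... | yes Pu = ℤ.≤-reflexive (sym (δ-≡ (unique Pu₀ Pu)))
        ... | no  _  = 0≤𝟙 (does (u₀ ≟ u))
      ∑-𝟙-atMostOne P? unique | no ∄P = subst (_≤ 1ℤ) (sym (∑-𝟙-none xs ∄P)) (+≤+ ℕ.z≤n)
        where
        ∑-𝟙-none : ∀ ys → ¬ Any _ ys → ∑[ u ∈ ys ] 𝟙 (does (P? u)) ≡ 0ℤ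
        ∑-𝟙-none []       _  = refl
        ∑-𝟙-none (y ∷ ys) ∄P with P? y
        ... | yes Py = contradiction (here Py) ∄P
        ... | no  _  = trans (ℤ.+-identityˡ _) (∑-𝟙-none ys (∄P ∘ there))

  open Delta using (Enumerates)

  ∑-allFin-suc : ∀ n (f : Fin (suc n) → ℤ) → ∑ (allFin (suc n)) f ≡ f zero + ∑[ i ∈ allFin n ] f (suc i)
  ∑-allFin-suc n f = cong (_+_ (f zero))
    (trans (cong (λ is → ∑ is f) (sym (List.map-tabulate id suc))) (∑-map suc (allFin n) f))

  allFin-enumerates : ∀ n → Enumerates Fin._≟_ (allFin n)
  allFin-enumerates n = record { once = once n }
    where
    once : ∀ n (i : Fin n) → ∑[ j ∈ allFin n ] Delta.δ Fin._≟_ i j ≡ 1ℤ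
    once (suc n) zero    = trans (∑-allFin-suc n (Delta.δ Fin._≟_ zero)) (cong (_+_ 1ℤ) (∑-zero (allFin n)))
    once (suc n) (suc i) = trans (∑-allFin-suc n (Delta.δ Fin._≟_ (suc i))) (trans (ℤ.+-identityˡ _) (once n i))

  map-enumerates : ∀ {_≟ᴬ_ : DecidableEquality A} {_≟ᴮ_ : DecidableEquality B} {xs} (f : A ↔ B) →
                   Enumerates _≟ᴬ_ xs → Enumerates _≟ᴮ_ (map (Inverse.to f) xs)
  map-enumerates {_≟ᴬ_ = _≟ᴬ_} {_≟ᴮ_} {xs} f enum = record { once = once }
    where
    open Inverse f
    δᴬ = Delta.δ _≟ᴬ_
    δᴮ = Delta.δ _≟ᴮ_
    δᴮ-to : ∀ b x → δᴮ b (to x) ≡ δᴬ (from b) x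
    δᴮ-to b x = cong 𝟙 (does-⇔ (mk⇔ inverseʳ (sym ∘ inverseˡ ∘ sym)) (b ≟ᴮ to x) (from b ≟ᴬ x))
    once : ∀ b → ∑[ y ∈ map to xs ] δᴮ b y ≡ 1ℤ
    once b = begin
      ∑[ y ∈ map to xs ] δᴮ b y  ≡⟨ ∑-map to xs (δᴮ b) ⟩
      ∑[ x ∈ xs ] δᴮ b (to x)    ≡⟨ ∑-cong xs (δᴮ-to b) ⟩
      ∑[ x ∈ xs ] δᴬ (from b) x  ≡⟨ Enumerates.once enum (from b) ⟩
      1ℤ                         ∎
      where open ≡-Reasoning

  cartesianProduct-enumerates : ∀ {_≟ᴬ_ : DecidableEquality A} {_≟ᴮ_ : DecidableEquality B} {xs ys} →
    Enumerates _≟ᴬ_ xs → Enumerates _≟ᴮ_ ys → Enumerates (≡-dec _≟ᴬ_ _≟ᴮ_) (cartesianProduct xs ys)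
  cartesianProduct-enumerates {_≟ᴬ_ = _≟ᴬ_} {_≟ᴮ_} {xs} {ys} enumˣ enumʸ = record { once = once }
    where
    open Delta (≡-dec _≟ᴬ_ _≟ᴮ_) using (δ)
    open Enumerates enumˣ renaming (once to onceˣ)
    open Enumerates enumʸ renaming (once to onceʸ)
    δᴬ = Delta.δ _≟ᴬ_
    δᴮ = Delta.δ _≟ᴮ_
    δ-pair : ∀ a b x y → δ (a , b) (x , y) ≡ δᴬ a x * δᴮ b y
    δ-pair a b x y = trans (cong 𝟙 (does-⇔ (mk⇔ ,-injective (uncurry (cong₂ _,_)))
                                           (≡-dec _≟ᴬ_ _≟ᴮ_ (a , b) (x , y)) (a ≟ᴬ x ×-dec b ≟ᴮ y)))
                           (𝟙-∧ (does (a ≟ᴬ x)) (does (b ≟ᴮ y)))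
    once : ∀ p → ∑ (cartesianProduct xs ys) (δ p) ≡ 1ℤ
    once (a , b) = begin
      ∑ (cartesianProduct xs ys) (δ (a , b))     ≡⟨ ∑-cartesianProduct xs ys _ ⟩
      ∑[ x ∈ xs ] ∑[ y ∈ ys ] δ (a , b) (x , y)  ≡⟨ ∑-cong xs (λ x → ∑-cong ys (δ-pair a b x)) ⟩
      ∑[ x ∈ xs ] ∑[ y ∈ ys ] (δᴬ a x * δᴮ b y)  ≡⟨ ∑∑-separable xs ys (δᴬ a) (δᴮ b) ⟩
      ∑[ x ∈ xs ] δᴬ a x * ∑[ y ∈ ys ] δᴮ b y    ≡⟨ cong₂ _*_ (onceˣ a) (onceʸ b) ⟩
      1ℤ                                         ∎
      where open ≡-Reasoning

  -- Pairing each i with σ i and counting the smaller member of each pair halves n.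
  fixedPointFreeInvolution⇒even : ∀ {n} (σ : Fin n → Fin n) → (∀ i → σ (σ i) ≡ i) → (∀ i → σ i ≢ i) →
                                  n % 2 ≡ 0
  fixedPointFreeInvolution⇒even {n} σ σσ≡id σi≢i = begin
    n % 2                   ≡⟨ cong (_% 2) (ℤ.+-injective (trans n≡X+X (cong₂ _+_ X≡m X≡m))) ⟩
    (m ℕ.+ m) % 2           ≡⟨ cong (_% 2) (trans (cong (m ℕ.+_) (sym (ℕ.+-identityʳ m))) (ℕ.*-comm 2 m)) ⟩
    (m ℕ.* 2) % 2           ≡⟨ m*n%n≡0 m 2 ⟩
    0                       ∎
    where
    open ≡-Reasoning
    [_<σ] : Fin n → ℤ
    [ i <σ] = 𝟙 (does (i Fin.<? σ i))
    X = ∑ (allFin n) [_<σ]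
    m = ∣ X ∣
    X≡m : X ≡ + m
    X≡m = sym (ℤ.0≤i⇒+∣i∣≡i (∑-nonNeg (allFin n) (λ i → 0≤𝟙 _)))
    exactlyOne : ∀ {i j : Fin n} → i ≢ j → 𝟙 (does (i Fin.<? j)) + 𝟙 (does (j Fin.<? i)) ≡ 1ℤ
    exactlyOne {i} {j} i≢j with Fin.<-cmp i j
    ... | tri< i<j _ j≮i = cong₂ _+_ (cong 𝟙 (dec-true (i Fin.<? j) i<j)) (cong 𝟙 (dec-false (j Fin.<? i) j≮i))
    ... | tri≈ _ i≡j _   = contradiction i≡j i≢j
    ... | tri> i≮j _ j<i = cong₂ _+_ (cong 𝟙 (dec-false (i Fin.<? j) i≮j)) (cong 𝟙 (dec-true (j Fin.<? i) j<i))
    n≡X+X : + n ≡ X + X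
    n≡X+X = begin
      + n
        ≡⟨ trans (sym (ℤ.*-identityʳ (+ n))) (cong (λ l → + l * 1ℤ) (sym (List.length-tabulate {n = n} id))) ⟩
      + length (allFin n) * 1ℤ
        ≡⟨ sym (∑-const (allFin n) 1ℤ) ⟩
      ∑[ i ∈ allFin n ] 1ℤ
        ≡⟨ ∑-cong (allFin n) (λ i → sym (exactlyOne (σi≢i i ∘ sym))) ⟩
      ∑[ i ∈ allFin n ] ([ i <σ] + 𝟙 (does (σ i Fin.<? i)))
        ≡⟨ ∑-distrib-+ (allFin n) [_<σ] _ ⟩
      X + ∑[ i ∈ allFin n ] 𝟙 (does (σ i Fin.<? i))
        ≡⟨ cong (_+_ X) (∑-cong (allFin n) (λ i → cong (λ j → 𝟙 (does (σ i Fin.<? j))) (sym (σσ≡id i)))) ⟩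
      X + ∑[ i ∈ allFin n ] [ σ i <σ]
        ≡⟨ cong (_+_ X) (Delta.∑-reindex Fin._≟_ (allFin-enumerates n) (mk↔ₛ′ σ σ σσ≡id σσ≡id) [_<σ]) ⟩
      X + X
        ∎

open Counting

module FieldFacts {q : ℕ} (F : FiniteField q) where

  open FiniteField F

  commutativeRing : CommutativeRing 0ℓ 0ℓ
  commutativeRing = record { isCommutativeRing = isCommutativeRing }

  open CommutativeRing commutativeRing
    using (+-group; commutativeSemiring; +-assoc; +-identityʳ; -‿inverseʳ; *-assoc; *-comm; *-identityˡ; zeroʳ)
  open import Algebra.Properties.Group +-group
    using (∙-cancelˡ; ∙-cancelʳ; ⁻¹-injective; x∙y⁻¹≈ε⇒x≈y; identityʳ-unique)
  open import Algebra.Solver.Ring.NaturalCoefficients.Default commutativeSemiring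

  2# : Carrier
  2# = 1# + 1#

  *-cancelˡ-≢0 : ∀ {x y z} → x ≢ 0# → x * y ≡ x * z → y ≡ z
  *-cancelˡ-≢0 {x} {y} {z} x≢0 xy≡xz with inverse x x≢0
  ... | x⁻¹ , xx⁻¹≡1 = trans (sym (undo y)) (trans (cong (x⁻¹ *_) xy≡xz) (undo z))
    where
    undo : ∀ w → x⁻¹ * (x * w) ≡ w
    undo w = begin
      x⁻¹ * (x * w)  ≡⟨ sym (*-assoc x⁻¹ x w) ⟩
      x⁻¹ * x * w    ≡⟨ cong (_* w) (trans (*-comm x⁻¹ x) xx⁻¹≡1) ⟩
      1# * w         ≡⟨ *-identityˡ w ⟩
      w              ∎
      where open ≡-Reasoning

  -- In characteristic 2, s ↦ s + 1 would be a fixed-point-free involution of F.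
  odd⇒2≢0 : q % 2 ≡ 1 → 2# ≢ 0#
  odd⇒2≢0 q-odd 2≡0 = contradiction (trans (sym q-odd) (fixedPointFreeInvolution⇒even σ σσ≡id σi≢i)) λ ()
    where
    open Inverse enum using (to; from; strictlyInverseˡ; strictlyInverseʳ; inverseˡ)
    σ : Fin q → Fin q
    σ i = from (to i + 1#)
    σσ≡id : ∀ i → σ (σ i) ≡ i
    σσ≡id i = begin
      from (to (from (to i + 1#)) + 1#)  ≡⟨ cong (λ s → from (s + 1#)) (strictlyInverseˡ (to i + 1#)) ⟩
      from (to i + 1# + 1#)              ≡⟨ cong from (trans (+-assoc (to i) 1# 1#) (cong (to i +_) 2≡0)) ⟩
      from (to i + 0#)                   ≡⟨ cong from (+-identityʳ (to i)) ⟩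
      from (to i)                        ≡⟨ strictlyInverseʳ i ⟩
      i                                  ∎
      where open ≡-Reasoning
    σi≢i : ∀ i → σ i ≢ i
    σi≢i i σi≡i = 0≢1 (sym (identityʳ-unique (to i) 1# (sym (inverseˡ (sym σi≡i)))))

  r : Carrier → Point → Carrier
  r u = parDist (u , 0#)

  parDist-shift : ∀ u s y → parDist (u , s) y ≡ s + r u y
  parDist-shift u s (a , b) =
    solve 4 (λ s b′ u a′ → (s :+ b′) :+ (u :+ a′) :* (u :+ a′) := s :+ ((con 0 :+ b′) :+ (u :+ a′) :* (u :+ a′)))
          refl s (- b) u (- a)

  parDist-shift-≡ : ∀ u s y y′ → parDist (u , s) y ≡ parDist (u , s) y′ ⇔ r u y ≡ r u y′
  parDist-shift-≡ u s y y′ = mk⇔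
    (λ eq → ∙-cancelˡ s _ _ (trans (sym (parDist-shift u s y)) (trans eq (parDist-shift u s y′))))
    (λ eq → trans (parDist-shift u s y) (trans (cong (s +_) eq) (sym (parDist-shift u s y′))))

  r-column-injective : ∀ u a {b b′} → r u (a , b) ≡ r u (a , b′) → b ≡ b′
  r-column-injective u a eq = ⁻¹-injective (∙-cancelˡ 0# _ _ (∙-cancelʳ ((u - a) * (u - a)) _ _ eq))

  -- r u y - r u y′ is affine in u with slope 2 (a′ - a). Stated without subtraction so that the
  -- semiring solver applies, with the negated variables as atoms.
  r-cross : ∀ u v a b a′ b′ → let d = (- a′) - (- a) in
            2# * (u * d) + (r u (a , b) + r v (a′ , b′)) ≡ 2# * (v * d) + (r u (a′ , b′) + r v (a , b))
  r-cross u v a b a′ b′ = begin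
    2# * (u * (α′ + nα)) + (r u (a , b) + r v (a′ , b′))
      ≡⟨ expandᵤ ⟩
    Z + 2# * (u * (α + nα))
      ≡⟨ cong (λ w → Z + 2# * w) (trans (annihilates u) (sym (annihilates v))) ⟩
    Z + 2# * (v * (α + nα))
      ≡⟨ expandᵥ ⟩
    2# * (v * (α′ + nα)) + (r u (a′ , b′) + r v (a , b))
      ∎
    where
    open ≡-Reasoning
    α = - a
    α′ = - a′
    β = - b
    β′ = - b′
    nα = - α
    Z = (β + β′) + (u * u + v * v) + (α * α + α′ * α′) + 2# * (u * α′ + v * α′)
    annihilates : ∀ w → w * (α + nα) ≡ 0#
    annihilates w = trans (cong (w *_) (-‿inverseʳ α)) (zeroʳ w)
    2ₚ : ∀ {n} → Polynomial n
    2ₚ = con 1 :+ con 1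
    rₚ : ∀ {n} → Polynomial n → Polynomial n → Polynomial n → Polynomial n
    rₚ u α β = (con 0 :+ β) :+ (u :+ α) :* (u :+ α)
    Zₚ : ∀ {n} → Polynomial n → Polynomial n → Polynomial n → Polynomial n → Polynomial n → Polynomial n → Polynomial n
    Zₚ u v α α′ β β′ = (β :+ β′) :+ (u :* u :+ v :* v) :+ (α :* α :+ α′ :* α′) :+ 2ₚ :* (u :* α′ :+ v :* α′)
    expandᵤ : 2# * (u * (α′ + nα)) + (r u (a , b) + r v (a′ , b′)) ≡ Z + 2# * (u * (α + nα))
    expandᵤ = solve 7 (λ u v α α′ β β′ nα →
      2ₚ :* (u :* (α′ :+ nα)) :+ (rₚ u α β :+ rₚ v α′ β′) := Zₚ u v α α′ β β′ :+ 2ₚ :* (u :* (α :+ nα)))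
      refl u v α α′ β β′ nα
    expandᵥ : Z + 2# * (v * (α + nα)) ≡ 2# * (v * (α′ + nα)) + (r u (a′ , b′) + r v (a , b))
    expandᵥ = solve 7 (λ u v α α′ β β′ nα →
      Zₚ u v α α′ β β′ :+ 2ₚ :* (v :* (α :+ nα)) := 2ₚ :* (v :* (α′ :+ nα)) :+ (rₚ u α′ β′ :+ rₚ v α β))
      refl u v α α′ β β′ nα

  r-equidistant-unique : 2# ≢ 0# → ∀ {y y′} → y ≢ y′ → ∀ {u v} → r u y ≡ r u y′ → r v y ≡ r v y′ → u ≡ v
  r-equidistant-unique 2≢0 {a , b} {a′ , b′} y≢y′ {u} {v} ru≡ rv≡ with a ≟ a′
  ... | yes refl = contradiction (cong (a ,_) (r-column-injective u a ru≡)) y≢y′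
  ... | no  a≢a′ = *-cancelʳ-≢0 d≢0 (*-cancelˡ-≢0 2≢0 (∙-cancelʳ (r u (a , b) + r v (a′ , b′)) _ _
                     (trans (r-cross u v a b a′ b′) (cong (2# * (v * d) +_) (cong₂ _+_ (sym ru≡) rv≡)))))
    where
    d = (- a′) - (- a)
    d≢0 : d ≢ 0#
    d≢0 d≡0 = a≢a′ (sym (⁻¹-injective (x∙y⁻¹≈ε⇒x≈y (- a′) (- a) d≡0)))
    *-cancelʳ-≢0 : ∀ {x y z} → x ≢ 0# → y * x ≡ z * x → y ≡ z
    *-cancelʳ-≢0 {x} {y} {z} x≢0 yx≡zx = *-cancelˡ-≢0 x≢0 (trans (*-comm x y) (trans yx≡zx (*-comm z x)))

module Energy {q : ℕ} (F : FiniteField q) (E : FiniteField.Point F → Bool) where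

  open import Data.Integer as ℤ using (ℤ; +_; 0ℤ; 1ℤ; _+_; -_; _-_; _*_; _^_; _≤_; +≤+; nonNegative)
  import Data.Integer.Properties as ℤ
  open import Data.Integer.Tactic.RingSolver using (solve-∀)
  open FiniteField F using (Carrier; Point; elems; points; parDist; _≟_; 0#; enum)
  open FieldFacts F using (2#; odd⇒2≢0; r; parDist-shift-≡; r-equidistant-unique)
  open Delta _≟_
  module Pt = Delta (≡-dec _≟_ _≟_)

  Q N K : ℤ
  Q = + q
  N = + size F E
  K = + KE F E

  e : Point → ℤ
  e x = 𝟙 (E x)

  0≤e : ∀ x → 0ℤ ≤ e x
  0≤e x = 0≤𝟙 (E x)

  ρ : Point → Carrier → ℤ
  ρ x t = ∑[ y ∈ points ] (e y * δ (parDist x y) t)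

  coincidences : Carrier → ℤ
  coincidences u = ∑[ y ∈ points ] ∑[ y′ ∈ points ] (e y * (e y′ * δ (r u y′) (r u y)))

  elems-enumerates : Enumerates elems
  elems-enumerates = map-enumerates enum (allFin-enumerates q)

  open Enumerates elems-enumerates using (once)

  points-enumerates : Pt.Enumerates points
  points-enumerates = cartesianProduct-enumerates elems-enumerates elems-enumerates

  length-elems : + length elems ≡ Q
  length-elems = cong +_ (trans (List.length-map (Inverse.to enum) (allFin q)) (List.length-tabulate id))

  ∑e≡N : ∑ points e ≡ N
  ∑e≡N = sym (count≡∑𝟙 E points)

  ν≡∑eρ : ∀ t → + ν F E t ≡ ∑[ x ∈ points ] (e x * ρ x t)
  ν≡∑eρ t = begin
    + ν F E t
      ≡⟨ count≡∑𝟙 _ (cartesianProduct points points) ⟩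
    ∑ (cartesianProduct points points) (λ (x , y) → 𝟙 (E x ∧ E y ∧ ⌊ parDist x y ≟ t ⌋))
      ≡⟨ ∑-cartesianProduct points points _ ⟩
    ∑[ x ∈ points ] ∑[ y ∈ points ] 𝟙 (E x ∧ E y ∧ ⌊ parDist x y ≟ t ⌋)
      ≡⟨ ∑-cong points (λ x → ∑-cong points (indicator x)) ⟩
    ∑[ x ∈ points ] ∑[ y ∈ points ] (e x * (e y * δ (parDist x y) t))
      ≡⟨ ∑-cong points (λ x → ∑-*ˡ points (e x) _) ⟩
    ∑[ x ∈ points ] (e x * ρ x t)
      ∎
    where
    open ≡-Reasoning
    indicator : ∀ x y → 𝟙 (E x ∧ E y ∧ ⌊ parDist x y ≟ t ⌋) ≡ e x * (e y * δ (parDist x y) t)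
    indicator x y = trans (𝟙-∧ (E x) _) (cong (e x *_) (trans (𝟙-∧ (E y) _) (cong (e y *_) (𝟙-does (parDist x y ≟ t)))))

  column≡ : ∀ u → + column F E u ≡ ∑[ b ∈ elems ] e (u , b)
  column≡ u = begin
    + column F E u
      ≡⟨ count≡∑𝟙 _ points ⟩
    ∑[ x ∈ points ] 𝟙 (E x ∧ ⌊ proj₁ x ≟ u ⌋)
      ≡⟨ ∑-cong points (λ x → trans (𝟙-∧ (E x) _) (cong (e x *_) (𝟙-does (proj₁ x ≟ u)))) ⟩
    ∑[ x ∈ points ] (e x * δ (proj₁ x) u)
      ≡⟨ trans (∑-cartesianProduct elems elems _) (∑-swap elems elems _) ⟩
    ∑[ b ∈ elems ] ∑[ a ∈ elems ] (e (a , b) * δ a u)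
      ≡⟨ ∑-cong elems (λ b → trans (∑-cong elems (λ a → flip a b)) (∑-δ elems-enumerates u (λ a → e (a , b)))) ⟩
    ∑[ b ∈ elems ] e (u , b)
      ∎
    where
    open ≡-Reasoning
    flip : ∀ a b → e (a , b) * δ a u ≡ δ u a * e (a , b)
    flip a b = trans (ℤ.*-comm (e (a , b)) _) (cong (_* e (a , b)) (δ-comm a u))

  column≤KE : ∀ u → column F E u ℕ.≤ KE F E
  column≤KE u = ∈⇒≤foldr-⊔ (∈-map⁺ (column F E) u∈elems)
    where
    open Inverse enum using (to; from; strictlyInverseˡ)
    u∈elems : u ∈ elems
    u∈elems = subst (_∈ elems) (strictlyInverseˡ u) (∈-map⁺ to (∈-allFin (from u)))

  ∑ρ≡N : ∀ x → ∑[ t ∈ elems ] ρ x t ≡ N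
  ∑ρ≡N x = begin
    ∑[ t ∈ elems ] ∑[ y ∈ points ] (e y * δ (parDist x y) t)  ≡⟨ ∑-swap elems points _ ⟩
    ∑[ y ∈ points ] ∑[ t ∈ elems ] (e y * δ (parDist x y) t)  ≡⟨ ∑-cong points (λ y → ∑-*ˡ elems (e y) _) ⟩
    ∑[ y ∈ points ] (e y * ∑[ t ∈ elems ] δ (parDist x y) t)  ≡⟨ ∑-cong points (λ y → cong (e y *_) (once (parDist x y))) ⟩
    ∑[ y ∈ points ] (e y * 1ℤ)                                ≡⟨ trans (∑-cong points (ℤ.*-identityʳ ∘ e)) ∑e≡N ⟩
    N                                                         ∎
    where open ≡-Reasoning

  ∑ν≡N² : ∑[ t ∈ elems ] (+ ν F E t) ≡ N ²
  ∑ν≡N² = begin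
    ∑[ t ∈ elems ] (+ ν F E t)                    ≡⟨ ∑-cong elems ν≡∑eρ ⟩
    ∑[ t ∈ elems ] ∑[ x ∈ points ] (e x * ρ x t)  ≡⟨ ∑-swap elems points _ ⟩
    ∑[ x ∈ points ] ∑[ t ∈ elems ] (e x * ρ x t)  ≡⟨ ∑-cong points (λ x → ∑-*ˡ elems (e x) (ρ x)) ⟩
    ∑[ x ∈ points ] (e x * ∑[ t ∈ elems ] ρ x t)  ≡⟨ ∑-cong points (λ x → cong (e x *_) (∑ρ≡N x)) ⟩
    ∑[ x ∈ points ] (e x * N)                     ≡⟨ trans (∑-*ʳ points N e) (cong (_* N) ∑e≡N) ⟩
    N ²                                           ∎
    where open ≡-Reasoning

  ∑ρ²≡coincidences : ∀ u s → ∑[ t ∈ elems ] (ρ (u , s) t ²) ≡ coincidences u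
  ∑ρ²≡coincidences u s = begin
    ∑[ t ∈ elems ] (ρ x t * ρ x t)
      ≡⟨ ∑-cong elems (λ t → sym (∑-*ʳ points (ρ x t) _)) ⟩
    ∑[ t ∈ elems ] ∑[ y ∈ points ] (e y * δ (parDist x y) t * ρ x t)
      ≡⟨ ∑-swap elems points _ ⟩
    ∑[ y ∈ points ] ∑[ t ∈ elems ] (e y * δ (parDist x y) t * ρ x t)
      ≡⟨ ∑-cong points (λ y → trans (∑-cong elems (λ t → ℤ.*-assoc (e y) _ _))
                                    (trans (∑-*ˡ elems (e y) _) (cong (e y *_) (∑-δ elems-enumerates _ (ρ x))))) ⟩
    ∑[ y ∈ points ] (e y * ρ x (parDist x y))
      ≡⟨ ∑-cong points (λ y → sym (∑-*ˡ points (e y) _)) ⟩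
    ∑[ y ∈ points ] ∑[ y′ ∈ points ] (e y * (e y′ * δ (parDist x y′) (parDist x y)))
      ≡⟨ ∑-cong points (λ y → ∑-cong points (λ y′ →
           cong (λ d → e y * (e y′ * d)) (δ-cong (parDist-shift-≡ u s y′ y)))) ⟩
    coincidences u
      ∎
    where
    open ≡-Reasoning
    x = (u , s)

  equidistant-count≤ : 2# ≢ 0# → ∀ y y′ → ∑[ u ∈ elems ] δ (r u y′) (r u y) ≤ Q * Pt.δ y y′ + 1ℤ
  equidistant-count≤ 2≢0 y y′ = byCases (≡-dec _≟_ _≟_ y y′)
    where
    open ℤ.≤-Reasoning
    byCases : Dec (y ≡ y′) → ∑[ u ∈ elems ] δ (r u y′) (r u y) ≤ Q * Pt.δ y y′ + 1ℤ
    byCases (yes y≡y′) = begin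
      ∑[ u ∈ elems ] δ (r u y′) (r u y)  ≤⟨ ∑-mono-≤ elems (λ u → 𝟙≤1 _) ⟩
      ∑[ u ∈ elems ] 1ℤ                  ≡⟨ trans (∑-const elems 1ℤ) (cong (_* 1ℤ) length-elems) ⟩
      Q * 1ℤ                             ≤⟨ ℤ.i≤i+j (Q * 1ℤ) 1ℤ ⟩
      Q * 1ℤ + 1ℤ                        ≡⟨ cong (λ d → Q * d + 1ℤ) (sym (Pt.δ-≡ y≡y′)) ⟩
      Q * Pt.δ y y′ + 1ℤ                 ∎
    byCases (no y≢y′) = begin
      ∑[ u ∈ elems ] δ (r u y′) (r u y)  ≤⟨ ∑-𝟙-atMostOne elems-enumerates (λ u → r u y′ ≟ r u y)
                                                          (r-equidistant-unique 2≢0 (y≢y′ ∘ sym)) ⟩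
      1ℤ                                 ≡⟨ cong (_+ 1ℤ) (sym (trans (cong (Q *_) (Pt.δ-≢ y≢y′)) (ℤ.*-zeroʳ Q))) ⟩
      Q * Pt.δ y y′ + 1ℤ                 ∎

  ∑coincidences≤ : 2# ≢ 0# → ∑ elems coincidences ≤ Q * N + N ²
  ∑coincidences≤ 2≢0 = begin
    ∑[ u ∈ elems ] ∑[ y ∈ points ] ∑[ y′ ∈ points ] (e y * (e y′ * δ (r u y′) (r u y)))
      ≡⟨ trans (∑-swap elems points _) (∑-cong points (λ y → ∑-swap elems points _)) ⟩
    ∑[ y ∈ points ] ∑[ y′ ∈ points ] ∑[ u ∈ elems ] (e y * (e y′ * δ (r u y′) (r u y)))
      ≡⟨ ∑-cong points (λ y → ∑-cong points (λ y′ →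
           trans (∑-*ˡ elems (e y) _) (cong (e y *_) (∑-*ˡ elems (e y′) _)))) ⟩
    ∑[ y ∈ points ] ∑[ y′ ∈ points ] (e y * (e y′ * ∑[ u ∈ elems ] δ (r u y′) (r u y)))
      ≤⟨ ∑-mono-≤ points (λ y → ∑-mono-≤ points (λ y′ →
           ℤ.*-monoˡ-≤-nonNeg (e y) {{nonNegative (0≤e y)}}
             (ℤ.*-monoˡ-≤-nonNeg (e y′) {{nonNegative (0≤e y′)}} (equidistant-count≤ 2≢0 y y′)))) ⟩
    ∑[ y ∈ points ] ∑[ y′ ∈ points ] (e y * (e y′ * (Q * Pt.δ y y′ + 1ℤ)))
      ≡⟨ ∑-cong points (λ y → trans (∑-cong points (λ y′ → split Q (e y) (e y′) (Pt.δ y y′)))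
                                     (trans (∑-distrib-+ points _ _) (cong₂ _+_ (diagonal y) (∑-*ˡ points (e y) e)))) ⟩
    ∑[ y ∈ points ] (Q * e y + e y * ∑ points e)
      ≡⟨ trans (∑-distrib-+ points _ _) (cong₂ _+_ (∑-*ˡ points Q e) (∑-*ʳ points (∑ points e) e)) ⟩
    Q * ∑ points e + ∑ points e * ∑ points e
      ≡⟨ cong (λ n → Q * n + n * n) ∑e≡N ⟩
    Q * N + N ²
      ∎
    where
    open ℤ.≤-Reasoning
    split : ∀ Q a b d → a * (b * (Q * d + 1ℤ)) ≡ Q * a * (d * b) + a * b
    split = solve-∀
    diagonal : ∀ y → ∑[ y′ ∈ points ] (Q * e y * (Pt.δ y y′ * e y′)) ≡ Q * e y
    diagonal y = begin-equality
      ∑[ y′ ∈ points ] (Q * e y * (Pt.δ y y′ * e y′))  ≡⟨ ∑-*ˡ points (Q * e y) _ ⟩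
      Q * e y * ∑[ y′ ∈ points ] (Pt.δ y y′ * e y′)    ≡⟨ cong (Q * e y *_) (Pt.∑-δ points-enumerates y e) ⟩
      Q * e y * e y                                    ≡⟨ trans (ℤ.*-assoc Q (e y) (e y)) (cong (Q *_) (𝟙-idem (E y))) ⟩
      Q * e y                                          ∎

  ∑-column≤ : ∀ (c : Carrier → ℤ) → (∀ u → 0ℤ ≤ c u) → ∑[ x ∈ points ] (e x * c (proj₁ x)) ≤ K * ∑ elems c
  ∑-column≤ c 0≤c = begin
    ∑[ x ∈ points ] (e x * c (proj₁ x))
      ≡⟨ ∑-cartesianProduct elems elems _ ⟩
    ∑[ a ∈ elems ] ∑[ b ∈ elems ] (e (a , b) * c a)
      ≡⟨ ∑-cong elems (λ a → trans (∑-*ʳ elems (c a) _) (cong (_* c a) (sym (column≡ a)))) ⟩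
    ∑[ a ∈ elems ] (+ column F E a * c a)
      ≤⟨ ∑-mono-≤ elems (λ a → ℤ.*-monoʳ-≤-nonNeg (c a) {{nonNegative (0≤c a)}} (+≤+ (column≤KE a))) ⟩
    ∑[ a ∈ elems ] (K * c a)
      ≡⟨ ∑-*ˡ elems K c ⟩
    K * ∑ elems c
      ∎
    where open ℤ.≤-Reasoning

  dispersion : Carrier → ℤ
  dispersion u = Q * (Q * coincidences u - N ²)

  ∑-deviation-ρ : ∀ u s → ∑[ t ∈ elems ] ((Q * ρ (u , s) t - N) ²) ≡ dispersion u
  ∑-deviation-ρ u s = trans (∑-deviation² elems (ρ (u , s)) length-elems (∑ρ≡N (u , s)))
                            (cong (λ c → Q * (Q * c - N ²)) (∑ρ²≡coincidences u s))

  0≤dispersion : ∀ u → 0ℤ ≤ dispersion u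
  0≤dispersion u = subst (0ℤ ≤_) (∑-deviation-ρ u 0#) (∑-nonNeg elems (λ t → 0≤i² (Q * ρ (u , 0#) t - N)))

  ∑dispersion≤ : 2# ≢ 0# → ∑ elems dispersion ≤ Q * Q * Q * N
  ∑dispersion≤ 2≢0 = begin
    ∑[ u ∈ elems ] (Q * (Q * coincidences u - N ²))
      ≡⟨ trans (∑-*ˡ elems Q _) (cong (Q *_) (∑-distrib-- elems _ _)) ⟩
    Q * (∑[ u ∈ elems ] (Q * coincidences u) - ∑[ u ∈ elems ] (N ²))
      ≡⟨ cong (Q *_) (cong₂ _-_ (∑-*ˡ elems Q coincidences) (trans (∑-const elems (N ²)) (cong (_* N ²) length-elems))) ⟩
    Q * (Q * ∑ elems coincidences - Q * N ²)
      ≤⟨ ℤ.*-monoˡ-≤-nonNeg Q (ℤ.+-monoˡ-≤ (- (Q * N ²)) (ℤ.*-monoˡ-≤-nonNeg Q (∑coincidences≤ 2≢0))) ⟩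
    Q * (Q * (Q * N + N ²) - Q * N ²)
      ≡⟨ collect Q N ⟩
    Q * Q * Q * N
      ∎
    where
    open ℤ.≤-Reasoning
    collect : ∀ Q N → Q * (Q * (Q * N + N * N) - Q * (N * N)) ≡ Q * Q * Q * N
    collect = solve-∀

  Qν-N²≡ : ∀ t → Q * + ν F E t - N ² ≡ ∑[ x ∈ points ] (e x * (Q * ρ x t - N))
  Qν-N²≡ t = sym (begin
    ∑[ x ∈ points ] (e x * (Q * ρ x t - N))
      ≡⟨ ∑-cong points (λ x → distribute Q N (e x) (ρ x t)) ⟩
    ∑[ x ∈ points ] (Q * (e x * ρ x t) + - N * e x)
      ≡⟨ ∑-distrib-+ points _ _ ⟩
    ∑[ x ∈ points ] (Q * (e x * ρ x t)) + ∑[ x ∈ points ] (- N * e x)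
      ≡⟨ cong₂ _+_ (∑-*ˡ points Q _) (∑-*ˡ points (- N) e) ⟩
    Q * ∑[ x ∈ points ] (e x * ρ x t) + - N * ∑ points e
      ≡⟨ cong₂ (λ v n → Q * v + - N * n) (sym (ν≡∑eρ t)) ∑e≡N ⟩
    Q * + ν F E t + - N * N
      ≡⟨ collect Q N (+ ν F E t) ⟩
    Q * + ν F E t - N ²
      ∎)
    where
    open ≡-Reasoning
    distribute : ∀ Q N a b → a * (Q * b - N) ≡ Q * (a * b) + - N * a
    distribute = solve-∀
    collect : ∀ Q N v → Q * v + - N * N ≡ Q * v - N * N
    collect = solve-∀

  variance≤ : 2# ≢ 0# → Q * (Q * ∑[ t ∈ elems ] ((+ ν F E t) ²) - (N ²) ²) ≤ Q * (Q * Q * N ² * K)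
  variance≤ 2≢0 = begin
    Q * (Q * ∑[ t ∈ elems ] ((+ ν F E t) ²) - (N ²) ²)
      ≡⟨ sym (∑-deviation² elems (λ t → + ν F E t) length-elems ∑ν≡N²) ⟩
    ∑[ t ∈ elems ] ((Q * + ν F E t - N ²) ²)
      ≡⟨ ∑-cong elems (λ t → cong _² (Qν-N²≡ t)) ⟩
    ∑[ t ∈ elems ] ((∑[ x ∈ points ] (e x * (Q * ρ x t - N))) ²)
      ≤⟨ ∑-mono-≤ elems (λ t → ∑-cauchySchwarz points e (λ x → Q * ρ x t - N) 0≤e) ⟩
    ∑[ t ∈ elems ] (∑ points e * ∑[ x ∈ points ] (e x * (Q * ρ x t - N) ²))
      ≡⟨ trans (∑-*ˡ elems (∑ points e) _) (cong₂ _*_ ∑e≡N (∑-swap elems points _)) ⟩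
    N * ∑[ x ∈ points ] ∑[ t ∈ elems ] (e x * (Q * ρ x t - N) ²)
      ≡⟨ cong (N *_) (∑-cong points (λ (u , s) →
           trans (∑-*ˡ elems (e (u , s)) _) (cong (e (u , s) *_) (∑-deviation-ρ u s)))) ⟩
    N * ∑[ x ∈ points ] (e x * dispersion (proj₁ x))
      ≤⟨ ℤ.*-monoˡ-≤-nonNeg N (∑-column≤ dispersion 0≤dispersion) ⟩
    N * (K * ∑ elems dispersion)
      ≤⟨ ℤ.*-monoˡ-≤-nonNeg N (ℤ.*-monoˡ-≤-nonNeg K (∑dispersion≤ 2≢0)) ⟩
    N * (K * (Q * Q * Q * N))
      ≡⟨ rearrange Q N K ⟩
    Q * (Q * Q * N ² * K)
      ∎
    where
    open ℤ.≤-Reasoning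
    rearrange : ∀ Q N K → N * (K * (Q * Q * Q * N)) ≡ Q * (Q * Q * (N * N) * K)
    rearrange = solve-∀

  energy-bound : q % 2 ≡ 1 → Q * ∑[ t ∈ elems ] ((+ ν F E t) ²) ≤ N ^ 4 + Q * Q * N ^ 2 * K
  energy-bound q-odd = begin
    Q * S                      ≡⟨ shift Q S N ⟩
    Q * S - (N ²) ² + (N ²) ²  ≤⟨ ℤ.+-monoˡ-≤ ((N ²) ²) (ℤ.*-cancelˡ-≤-pos _ _ Q {{Q>0}} (variance≤ 2≢0)) ⟩
    Q * Q * N ² * K + (N ²) ²  ≡⟨ collect Q N K ⟩
    N ^ 4 + Q * Q * N ^ 2 * K  ∎
    where
    open ℤ.≤-Reasoning
    S = ∑[ t ∈ elems ] ((+ ν F E t) ²)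
    2≢0 = odd⇒2≢0 q-odd
    Q>0 : ℤ.Positive Q
    Q>0 = ℤ.positive (ℤ.+<+ (ℕ.n≢0⇒n>0 λ { refl → contradiction q-odd λ () }))
    shift : ∀ Q S N → Q * S ≡ Q * S - (N * N) * (N * N) + (N * N) * (N * N)
    shift = solve-∀
    collect : ∀ Q N K → Q * Q * (N * N) * K + (N * N) * (N * N)
                        ≡ N * (N * (N * (N * 1ℤ))) + Q * Q * (N * (N * 1ℤ)) * K
    collect = solve-∀

  +sumν²≡ : + (q ℕ.* sumν² F E) ≡ Q * ∑[ t ∈ elems ] ((+ ν F E t) ²)
  +sumν²≡ = trans (ℤ.pos-* q (sumν² F E)) (cong (Q *_) (pos-∑-² (ν F E) elems))

  +bound≡ : + (size F E ℕ.^ 4 ℕ.+ q ℕ.* q ℕ.* size F E ℕ.^ 2 ℕ.* KE F E) ≡ N ^ 4 + Q * Q * N ^ 2 * K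
  +bound≡ = trans (ℤ.pos-+ (s ℕ.^ 4) (q ℕ.* q ℕ.* s ℕ.^ 2 ℕ.* KE F E)) (cong₂ _+_ (pos-^ s 4)
    (trans (ℤ.pos-* (q ℕ.* q ℕ.* s ℕ.^ 2) (KE F E))
           (cong (_* K) (trans (ℤ.pos-* (q ℕ.* q) (s ℕ.^ 2)) (cong₂ _*_ (ℤ.pos-* q q) (pos-^ s 2))))))
    where s = size F E

open import Data.Nat using (_*_; _+_; _^_; _≤_)
import Data.Integer as ℤ
open import Data.Integer.Properties using (drop‿+≤+)

proposition5p3 : (q : ℕ) → IsPrimePower q → q % 2 ≡ 1 →
    (F : FiniteField q) → (E : FiniteField.Point F → Bool) →
    q * sumν² F E ≤ size F E ^ 4 + q * q * (size F E ^ 2) * KE F E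
proposition5p3 q _ q-odd F E = drop‿+≤+ (subst₂ ℤ._≤_ (sym +sumν²≡) (sym +bound≡) (energy-bound q-odd))
  where
  open Energy F E
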